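{- Let $R$ be a $p_2$-orientation of $P_n$. Remove any $k-1$ flat edges of $R$ from $P_n$, obtaining $k$ vertex-disjoint paths $Q_1,\dots,Q_k$, and let $R_1,\dots,R_k$ be the restrictions of $R$ to them. For a path $Q$ with orientation $S$, let $N(Q,S)$ be the number of $p_2$-configurations on $Q$ inducing $S$ in which the rightmost vertex of $Q$ has stack size $0$. Then $$N(P_n,R)=\prod_{i=1}^k N(Q_i,R_i).$$
   Context: Parallel Diffusion on a finite simple graph $G$: a configuration assigns an integer stack size $|v|$ (possibly negative) to each vertex. In one step all vertices fire simultaneously: each vertex sends one chip to each neighbour with strictly smaller stack size. Starting from $C_0$, $C_{t+1}$ is obtained from $C_t$ by one step. A configuration $D$ is a $p_2$-configuration if there are $C_0$ and $N$ such that $C_{t+2}=C_t$ and $C_{t+1}\ne C_t$ for all $t\ge N$, and $D=C_t$ for some $t\ge N$. The path $P_n$ has vertices $v_1,\dots,v_n$ and edges $e_i=v_iv_{i+1}$, drawn horizontally with $v_1$ rightmost (so the rightmost vertex of a subpath is its vertex of smallest index). A configuration induces the orientation in which each edge is directed from its endpoint with larger stack size to its endpoint with smaller stack size, and is flat if equal; a $p_2$-orientation is one induced by a $p_2$-configuration. -}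

module Defs where

open import Data.Nat using (ℕ; zero; suc; _≤_; _+_)
open import Data.Fin using (Fin; zero; suc; toℕ)
open import Data.Bool using (Bool; true; false; if_then_else_)
open import Data.Integer as ℤ using (ℤ; 0ℤ; 1ℤ; _-_; _<?_)
open import Data.List using (List; []; _∷_; foldr; map; intercalate)
open import Data.List.Relation.Unary.All using (All)
open import Data.Product using (Σ; ∃; _×_; _,_)
open import Relation.Nullary using (¬_; does; yes; no)
open import Relation.Nullary.Decidable using (dec-false)
import Data.Nat as ℕ
import Data.Nat.Properties as ℕP
open import Data.Bool using (_∨_)
open import Data.Bool.Properties using (∨-comm)
open import Relation.Binary.PropositionalEquality using (_≡_; _≢_; refl; sym)
open import Function using (_∘_)
import Data.List as L

record Graph (n : ℕ) : Set where
  field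
    adj     : Fin n → Fin n → Bool
    symm    : ∀ u v → adj u v ≡ adj v u
    irrefl  : ∀ v → adj v v ≡ false
open Graph public

Config : ℕ → Set
Config n = Fin n → ℤ

_≈C_ : ∀ {n} → Config n → Config n → Set
C ≈C D = ∀ v → C v ≡ D v

sumℤ : List ℤ → ℤ
sumℤ = foldr ℤ._+_ 0ℤ

ind : Bool → ℤ
ind b = if b then 1ℤ else 0ℤ

-- net chip change of v caused by its neighbour u:
-- +1 if |u| > |v| (u sends v a chip), -1 if |v| > |u| (v sends u a chip)
flowFrom : ∀ {n} → Graph n → Config n → Fin n → Fin n → ℤ
flowFrom G C v u =
  if adj G v u then ind (does (C v <? C u)) - ind (does (C u <? C v)) else 0ℤ

-- one step of Parallel Diffusion: all vertices fire simultaneously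
step : ∀ {n} → Graph n → Config n → Config n
step {n} G C v = C v ℤ.+ sumℤ (map (flowFrom G C v) (L.allFin n))

iter : ∀ {n} → Graph n → Config n → ℕ → Config n
iter G C zero    = C
iter G C (suc t) = step G (iter G C t)

IsP2 : ∀ {n} → Graph n → Config n → Set
IsP2 G D =
  Σ (Config _) λ C₀ → Σ ℕ λ N →
    (∀ t → N ≤ t →
        (iter G C₀ (suc (suc t)) ≈C iter G C₀ t)
      × ¬ (iter G C₀ (suc t) ≈C iter G C₀ t))
    × (Σ ℕ λ t → N ≤ t × (D ≈C iter G C₀ t))

-- The path P_n: vertex v_{i+1} is Fin element i; v_i ~ v_{i+1}

pathAdj : ∀ n → Fin n → Fin n → Bool
pathAdj n i j = does (suc (toℕ i) ℕ.≟ toℕ j) ∨ does (suc (toℕ j) ℕ.≟ toℕ i)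

pathAdj-symm : ∀ n i j → pathAdj n i j ≡ pathAdj n j i
pathAdj-symm n i j = ∨-comm (does (suc (toℕ i) ℕ.≟ toℕ j)) (does (suc (toℕ j) ℕ.≟ toℕ i))

private
  sucn≢n : ∀ m → does (suc m ℕ.≟ m) ≡ false
  sucn≢n m = dec-false (suc m ℕ.≟ m) ℕP.1+n≢n

pathAdj-irrefl : ∀ n v → pathAdj n v v ≡ false
pathAdj-irrefl n v rewrite sucn≢n (toℕ v) = refl

pathGraph : ∀ n → Graph n
pathGraph n = record { adj = pathAdj n ; symm = pathAdj-symm n ; irrefl = pathAdj-irrefl n }

-- Edge e_i = v_i v_{i+1}.
--   flat : |v_i| = |v_{i+1}|
--   down : directed from v_{i+1} to v_i   (|v_{i+1}| > |v_i|)
--   up   : directed from v_i to v_{i+1}   (|v_i| > |v_{i+1}|)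
-- An orientation of P_n (n ≥ 1) is the list [e_1, …, e_{n-1}].

data EdgeOri : Set where
  flat down up : EdgeOri

edgeOri : ℤ → ℤ → EdgeOri
edgeOri a b with a ℤ.<? b | b ℤ.<? a
... | yes _ | _     = down
... | no _  | yes _ = up
... | no _  | no _  = flat

inducedOri : ∀ n → Config n → List EdgeOri
inducedOri zero          C = []
inducedOri (suc zero)    C = []
inducedOri (suc (suc n)) C = edgeOri (C zero) (C (suc zero)) ∷ inducedOri (suc n) (C ∘ suc)

IsP2Orientation : ∀ n → List EdgeOri → Set
IsP2Orientation n R = Σ (Config n) λ D → IsP2 (pathGraph n) D × inducedOri n D ≡ R

-- The configurations counted by N(Q,S), for Q = P_{suc m} with orientation S:
-- p₂-configurations on Q inducing S whose rightmost vertex v_1 has stack size 0.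
NPred : ∀ m → List EdgeOri → Config (suc m) → Set
NPred m S D = IsP2 (pathGraph (suc m)) D × inducedOri (suc m) D ≡ S × D zero ≡ 0ℤ

-- "exactly c configurations (up to equality of configurations) satisfy P"
record Counts {n : ℕ} (P : Config n → Set) (c : ℕ) : Set where
  field
    enum     : Fin c → Config n
    sound    : ∀ i → P (enum i)
    complete : ∀ D → P D → Σ (Fin c) λ i → D ≈C enum i
    distinct : ∀ i j → enum i ≈C enum j → i ≡ j

-- On a path, a configuration returns after two steps iff the flow across every edge reverses at each
-- step, and it is fixed iff it is flat. Cut the path at a flat edge and lower the second piece so that
-- its first vertex has height 0. The pieces evolve independently while the cut edge stays flat, and it
-- stays flat after one step iff its two ends gain equally, which depends only on the orientations of
-- the pieces. Moreover a flat piece would force the flow into the other piece to vanish and so flatten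
-- the whole path. Hence gluing is a bijection between the p₂-configurations counted on the path and
-- pairs of those counted on the pieces, and the product formula follows by induction on the pieces.

module Submission where

open import Defs
open import Data.Nat using (ℕ; suc)
open import Data.List using (List; []; _∷_; length; intercalate)
open import Data.Nat.ListAction using (product)
open import Data.List.Relation.Binary.Pointwise using (Pointwise)
open import Relation.Binary.PropositionalEquality using (_≡_; _≢_)

open import Algebra.Bundles using (AbelianGroup)
open import Data.Nat using (zero; z≤n; _*_) renaming (_+_ to _+ℕ_)
open import Data.Nat.Properties using (*-identityʳ; suc-injective)
open import Data.Fin using (Fin; zero; suc; combine; remQuot)
open import Data.Fin.Properties using (remQuot-combine; combine-remQuot)
open import Data.Integer using (ℤ; 0ℤ; 1ℤ; -1ℤ; -_; _-_; _<?_; _+_; _<_)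
import Data.Integer.Properties as ℤ
open import Data.Integer.Tactic.RingSolver using (solve-∀)
open import Data.List using (_++_; map; tabulate; allFin)
open import Data.List.Properties using (∷-injectiveˡ; ∷-injectiveʳ; length-++; map-tabulate; map-cong)
open import Data.List.Relation.Binary.Pointwise using ([]; _∷_)
open import Data.Product using (Σ; _×_; _,_; proj₁; proj₂; uncurry)
open import Data.Unit using (⊤; tt)
open import Data.Bool using (Bool; true; false; if_then_else_)
open import Data.Empty using (⊥-elim)
open import Function using (_∘_; _⇔_; mk⇔; Equivalence; case_of_)
open import Data.Product.Function.NonDependent.Propositional using (_×-⇔_)
open import Relation.Nullary using (¬_; does; yes; no)
open import Relation.Nullary.Decidable using (does-⇔; dec-true; dec-false)
open import Relation.Binary.Definitions using (tri<; tri≈; tri>)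
open import Relation.Binary.PropositionalEquality using (refl; sym; trans; cong; cong₂; subst; subst₂; module ≡-Reasoning)

open import Algebra.Properties.Group (AbelianGroup.group ℤ.+-0-abelianGroup)
  using (identityʳ-unique; ∙-cancelˡ; //-rightDividesˡ; //-rightDividesʳ)

x+y≡x⇔y≡0 : ∀ x y → (x + y ≡ x) ⇔ (y ≡ 0ℤ)
x+y≡x⇔y≡0 x y = mk⇔ (identityʳ-unique x y) (λ y≡0 → trans (cong (x +_) y≡0) (ℤ.+-identityʳ x))

x+y≡0∧x≡0⇒y≡0 : ∀ {x y} → x + y ≡ 0ℤ → x ≡ 0ℤ → y ≡ 0ℤ
x+y≡0∧x≡0⇒y≡0 {y = y} x+y≡0 refl = trans (sym (ℤ.+-identityˡ y)) x+y≡0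

++-injective : ∀ {A : Set} (xs xs′ : List A) {ys ys′ : List A} → length xs ≡ length xs′ → xs ++ ys ≡ xs′ ++ ys′ →
  xs ≡ xs′ × ys ≡ ys′
++-injective []       []         _     eq = refl , eq
++-injective (x ∷ xs) (x′ ∷ xs′) |xs|≡ eq =
  let (xs≡ , ys≡) = ++-injective xs xs′ (suc-injective |xs|≡) (∷-injectiveʳ eq) in
  cong₂ _∷_ (∷-injectiveˡ eq) xs≡ , ys≡

record Splitting (n a b : ℕ) : Set where
  field
    join           : Config a → Config b → Config n
    first          : Config n → Config a
    second         : Config n → Config b
    join-split     : ∀ z → z ≈C join (first z) (second z)
    first-join     : ∀ x y → first (join x y) ≈C x
    second-join    : ∀ x y → second (join x y) ≈C y
    join-cong      : ∀ {x x′ y y′} → x ≈C x′ → y ≈C y′ → join x y ≈C join x′ y′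
    first-cong     : ∀ {z z′} → z ≈C z′ → first z ≈C first z′
    second-cong    : ∀ {z z′} → z ≈C z′ → second z ≈C second z′

Counts-× : ∀ {n a b} {P : Config n → Set} {P₁ : Config a → Set} {P₂ : Config b → Set} {c₁ c₂ : ℕ} →
  (s : Splitting n a b) → let open Splitting s in
  (∀ x y → P₁ x → P₂ y → P (join x y)) → (∀ z → P z → P₁ (first z) × P₂ (second z)) →
  Counts P₁ c₁ → Counts P₂ c₂ → Counts P (c₁ * c₂)
Counts-× {n} {P = P} {c₁ = c₁} {c₂} s joinP splitP count₁ count₂ = record
  { enum = enum ; sound = sound ; complete = complete ; distinct = distinct }
  where
  open Splitting s
  module C₁ = Counts count₁
  module C₂ = Counts count₂
  enum : Fin (c₁ * c₂) → Config n
  enum k = join (C₁.enum (proj₁ (remQuot {c₁} c₂ k))) (C₂.enum (proj₂ (remQuot {c₁} c₂ k)))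
  sound : ∀ k → P (enum k)
  sound k = joinP _ _ (C₁.sound _) (C₂.sound _)
  complete : ∀ z → P z → Σ (Fin (c₁ * c₂)) λ k → z ≈C enum k
  complete z pz =
    let (i , zᵢ) = C₁.complete (first z) (proj₁ (splitP z pz))
        (j , zⱼ) = C₂.complete (second z) (proj₂ (splitP z pz))
    in combine i j , λ v → trans (join-split z v) (trans (join-cong zᵢ zⱼ v)
         (cong (λ (i , j) → join (C₁.enum i) (C₂.enum j) v) (sym (remQuot-combine {c₁} {c₂} i j))))
  distinct : ∀ k k′ → enum k ≈C enum k′ → k ≡ k′
  distinct k k′ same = begin
    k                                           ≡⟨ combine-remQuot {c₁} c₂ k ⟨
    uncurry combine (remQuot {c₁} c₂ k)         ≡⟨ cong (uncurry combine) (cong₂ _,_ sameFirst sameSecond) ⟩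
    uncurry combine (remQuot {c₁} c₂ k′)        ≡⟨ combine-remQuot {c₁} c₂ k′ ⟩
    k′                                          ∎
    where
    open ≡-Reasoning
    sameFirst : proj₁ (remQuot {c₁} c₂ k) ≡ proj₁ (remQuot {c₁} c₂ k′)
    sameFirst = C₁.distinct _ _ (λ v → trans (sym (first-join _ _ v)) (trans (first-cong same v) (first-join _ _ v)))
    sameSecond : proj₂ (remQuot {c₁} c₂ k) ≡ proj₂ (remQuot {c₁} c₂ k′)
    sameSecond = C₂.distinct _ _ (λ v → trans (sym (second-join _ _ v)) (trans (second-cong same v) (second-join _ _ v)))

inflow : ℤ → ℤ → ℤ
inflow a b = ind (does (a <? b)) - ind (does (b <? a))

inflow-antisym : ∀ a b → inflow b a ≡ - inflow a b
inflow-antisym a b with a <? b | b <? a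
... | yes a<b | yes b<a = ⊥-elim (ℤ.<-asym a<b b<a)
... | yes _   | no _    = refl
... | no _    | yes _   = refl
... | no _    | no _    = refl

inflow-self : ∀ {a b} → a ≡ b → inflow a b ≡ 0ℤ
inflow-self {a} refl rewrite dec-false (a <? a) (ℤ.<-irrefl refl) = refl

inflow-< : ∀ {a b} → a < b → inflow a b ≡ 1ℤ
inflow-< {a} {b} a<b rewrite dec-true (a <? b) a<b | dec-false (b <? a) (ℤ.<-asym a<b) = refl

inflow≡0⇒≡ : ∀ a b → inflow a b ≡ 0ℤ → a ≡ b
inflow≡0⇒≡ a b e with ℤ.<-cmp a b
... | tri≈ _ a≡b _ = a≡b
... | tri< a<b _ _ = case trans (sym e) (inflow-< a<b) of λ ()
... | tri> _ _ b<a = case trans (sym e) (trans (inflow-antisym b a) (cong -_ (inflow-< b<a))) of λ ()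

inflow-reversed : ∀ a b c d → inflow a b + inflow c d ≡ 0ℤ → inflow b a + inflow d c ≡ 0ℤ
inflow-reversed a b c d sum≡0 = begin
  inflow b a + inflow d c       ≡⟨ cong₂ _+_ (inflow-antisym a b) (inflow-antisym c d) ⟩
  - inflow a b + - inflow c d   ≡⟨ ℤ.neg-distrib-+ (inflow a b) (inflow c d) ⟨
  - (inflow a b + inflow c d)   ≡⟨ cong -_ sum≡0 ⟩
  0ℤ                            ∎
  where open ≡-Reasoning

does-<-+ʳ : ∀ a b c → does (a + c <? b + c) ≡ does (a <? b)
does-<-+ʳ a b c = does-⇔ (mk⇔ cancel (ℤ.+-monoˡ-< c)) (a + c <? b + c) (a <? b)
  where
  cancel : a + c < b + c → a < b
  cancel h = subst₂ _<_ (//-rightDividesʳ c a) (//-rightDividesʳ c b) (ℤ.+-monoˡ-< (- c) h)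

inflow-+ʳ : ∀ a b c → inflow (a + c) (b + c) ≡ inflow a b
inflow-+ʳ a b c = cong₂ (λ p q → ind p - ind q) (does-<-+ʳ a b c) (does-<-+ʳ b a c)

edgeInflow : EdgeOri → ℤ
edgeInflow flat = 0ℤ
edgeInflow down = 1ℤ
edgeInflow up   = -1ℤ

inflow≡edgeInflow : ∀ a b → inflow a b ≡ edgeInflow (edgeOri a b)
inflow≡edgeInflow a b with a <? b | b <? a
... | yes a<b | yes b<a = ⊥-elim (ℤ.<-asym a<b b<a)
... | yes _   | no _    = refl
... | no _    | yes _   = refl
... | no _    | no _    = refl

oriOf : Bool → Bool → EdgeOri
oriOf true  _     = down
oriOf false true  = up
oriOf false false = flat

edgeOri≡oriOf : ∀ a b → edgeOri a b ≡ oriOf (does (a <? b)) (does (b <? a))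
edgeOri≡oriOf a b with a <? b | b <? a
... | yes _ | _     = refl
... | no _  | yes _ = refl
... | no _  | no _  = refl

edgeOri-+ʳ : ∀ a b c → edgeOri (a + c) (b + c) ≡ edgeOri a b
edgeOri-+ʳ a b c = begin
  edgeOri (a + c) (b + c)                         ≡⟨ edgeOri≡oriOf (a + c) (b + c) ⟩
  oriOf (does (a + c <? b + c)) (does (b + c <? a + c)) ≡⟨ cong₂ oriOf (does-<-+ʳ a b c) (does-<-+ʳ b a c) ⟩
  oriOf (does (a <? b)) (does (b <? a))           ≡⟨ edgeOri≡oriOf a b ⟨
  edgeOri a b                                     ∎
  where open ≡-Reasoning

edgeOri-self : ∀ {a b} → a ≡ b → edgeOri a b ≡ flat
edgeOri-self {a} refl = trans (edgeOri≡oriOf a a) (cong₂ oriOf a≮a a≮a)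
  where
  a≮a : does (a <? a) ≡ false
  a≮a = dec-false (a <? a) (ℤ.<-irrefl refl)

edgeOri≡flat⇒≡ : ∀ a b → edgeOri a b ≡ flat → a ≡ b
edgeOri≡flat⇒≡ a b isFlat = inflow≡0⇒≡ a b (trans (inflow≡edgeInflow a b) (cong edgeInflow isFlat))

step-cong : ∀ {n} (G : Graph n) {C D : Config n} → C ≈C D → step G C ≈C step G D
step-cong {n} G {C} {D} C≈D v = cong₂ _+_ (C≈D v) (cong sumℤ (map-cong flow≡ (allFin n)))
  where
  flow≡ : ∀ u → flowFrom G C v u ≡ flowFrom G D v u
  flow≡ u = cong₂ (λ a b → if adj G v u then inflow a b else 0ℤ) (C≈D v) (C≈D u)

IsP2-cong : ∀ {n} (G : Graph n) {C D : Config n} → C ≈C D → IsP2 G C → IsP2 G D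
IsP2-cong G C≈D (C₀ , N , periodic , t , N≤t , C≈Cₜ) =
  C₀ , N , periodic , t , N≤t , λ v → trans (sym (C≈D v)) (C≈Cₜ v)

HasExactPeriod2 : ∀ {n} → Graph n → Config n → Set
HasExactPeriod2 G D = step G (step G D) ≈C D × ¬ (step G D ≈C D)

IsP2⇔exactPeriod2 : ∀ {n} (G : Graph n) (D : Config n) → IsP2 G D ⇔ HasExactPeriod2 G D
IsP2⇔exactPeriod2 G D = mk⇔ to from
  where
  to : IsP2 G D → HasExactPeriod2 G D
  to (C₀ , N , periodic , t , N≤t , D≈Cₜ) =
    (λ v → trans (step-cong G (step-cong G D≈Cₜ) v) (trans (proj₁ (periodic t N≤t) v) (sym (D≈Cₜ v)))) ,
    (λ fixed → proj₂ (periodic t N≤t) (λ v → trans (step-cong G (λ w → sym (D≈Cₜ w)) v) (trans (fixed v) (D≈Cₜ v))))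
  from : HasExactPeriod2 G D → IsP2 G D
  from (period2 , notFixed) = D , 0 , (λ t _ → period2-from t , notFixed-from t) , 0 , z≤n , (λ v → refl)
    where
    period2-from : ∀ t → iter G D (suc (suc t)) ≈C iter G D t
    period2-from zero    = period2
    period2-from (suc t) = step-cong G (period2-from t)
    notFixed-from : ∀ t → ¬ (iter G D (suc t) ≈C iter G D t)
    notFixed-from zero    = notFixed
    notFixed-from (suc t) fixed = notFixed-from t (λ v → trans (sym (fixed v)) (period2-from t v))

-- Diffusion on a path

headInflow : ∀ m → Config (suc m) → ℤ
headInflow zero    x = 0ℤ
headInflow (suc m) x = inflow (x zero) (x (suc zero))

-- One step on the path v₁ … v_{m+1} in which v₁ also gains b chips from outside, so that
-- its tail v₂ … v_{m+1} is again such a path.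
pathStep : ∀ m → ℤ → Config (suc m) → Config (suc m)
pathStep m       b x zero    = x zero + b + headInflow m x
pathStep (suc m) b x (suc v) = pathStep m (inflow (x (suc zero)) (x zero)) (x ∘ suc) v

pathGain : ∀ n → Config n → Fin n → ℤ
pathGain n x v = sumℤ (tabulate (flowFrom (pathGraph n) x v))

atHead : ∀ {m} → Fin m → ℤ → ℤ
atHead zero    b = b
atHead (suc _) _ = 0ℤ

headInflow≡pathGain : ∀ m (x : Config (suc m)) → headInflow m x ≡ pathGain (suc m) x zero
headInflow≡pathGain zero    x = refl
headInflow≡pathGain (suc m) x =
  sym (trans (ℤ.+-identityˡ _) (trans (cong (inflow (x zero) (x (suc zero)) +_) (sum-zeros m)) (ℤ.+-identityʳ _)))
  where
  sum-zeros : ∀ k → sumℤ (tabulate {n = k} (λ _ → 0ℤ)) ≡ 0ℤ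
  sum-zeros zero    = refl
  sum-zeros (suc k) = trans (ℤ.+-identityˡ _) (sum-zeros k)

pathGain-suc : ∀ m (x : Config (suc (suc m))) v →
  pathGain (suc (suc m)) x (suc v) ≡ atHead v (inflow (x (suc zero)) (x zero)) + pathGain (suc m) (x ∘ suc) v
pathGain-suc m x zero    = refl
pathGain-suc m x (suc v) = refl

pathStep≡pathGain : ∀ m b (x : Config (suc m)) v → pathStep m b x v ≡ x v + atHead v b + pathGain (suc m) x v
pathStep≡pathGain m       b x zero    = cong (x zero + b +_) (headInflow≡pathGain m x)
pathStep≡pathGain (suc m) b x (suc v) = begin
  pathStep m c (x ∘ suc) v                                 ≡⟨ pathStep≡pathGain m c (x ∘ suc) v ⟩
  x (suc v) + atHead v c + pathGain (suc m) (x ∘ suc) v    ≡⟨ ℤ.+-assoc (x (suc v)) _ _ ⟩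
  x (suc v) + (atHead v c + pathGain (suc m) (x ∘ suc) v)  ≡⟨ cong (x (suc v) +_) (pathGain-suc m x v) ⟨
  x (suc v) + pathGain (suc (suc m)) x (suc v)             ≡⟨ cong (_+ pathGain _ x (suc v)) (ℤ.+-identityʳ (x (suc v))) ⟨
  x (suc v) + 0ℤ + pathGain (suc (suc m)) x (suc v)        ∎
  where
  open ≡-Reasoning
  c = inflow (x (suc zero)) (x zero)

step-pathGraph : ∀ m (x : Config (suc m)) → step (pathGraph (suc m)) x ≈C pathStep m 0ℤ x
step-pathGraph m x v = begin
  x v + sumℤ (map (flowFrom (pathGraph (suc m)) x v) (allFin (suc m)))
    ≡⟨ cong (λ l → x v + sumℤ l) (map-tabulate (λ u → u) (flowFrom (pathGraph (suc m)) x v)) ⟩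
  x v + pathGain (suc m) x v                  ≡⟨ cong (_+ pathGain (suc m) x v) (ℤ.+-identityʳ (x v)) ⟨
  x v + 0ℤ + pathGain (suc m) x v             ≡⟨ cong (λ g → x v + g + pathGain (suc m) x v) (atHead-0 v) ⟨
  x v + atHead v 0ℤ + pathGain (suc m) x v    ≡⟨ pathStep≡pathGain m 0ℤ x v ⟨
  pathStep m 0ℤ x v                           ∎
  where
  open ≡-Reasoning
  atHead-0 : ∀ {k} (u : Fin k) → atHead u 0ℤ ≡ 0ℤ
  atHead-0 zero    = refl
  atHead-0 (suc _) = refl

TwoPeriodic : ∀ m → ℤ → ℤ → Config (suc m) → Set
TwoPeriodic m b₀ b₁ x = pathStep m b₁ (pathStep m b₀ x) ≈C x

Fixed : ∀ m → ℤ → Config (suc m) → Set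
Fixed m b x = pathStep m b x ≈C x

twoStepFlow : ∀ m → ℤ → Config (suc (suc m)) → ℤ
twoStepFlow m b x =
  inflow (x zero) (x (suc zero)) + inflow (pathStep (suc m) b x zero) (pathStep (suc m) b x (suc zero))

FlowsReverse : ∀ m → ℤ → Config (suc m) → Set
FlowsReverse zero    b x = ⊤
FlowsReverse (suc m) b x = twoStepFlow m b x ≡ 0ℤ × FlowsReverse m (inflow (x (suc zero)) (x zero)) (x ∘ suc)

tailGainsCancel : ∀ m b (x : Config (suc (suc m))) → twoStepFlow m b x ≡ 0ℤ →
  inflow (x (suc zero)) (x zero) + inflow (pathStep (suc m) b x (suc zero)) (pathStep (suc m) b x zero) ≡ 0ℤ
tailGainsCancel m b x = inflow-reversed (x zero) (x (suc zero)) (pathStep (suc m) b x zero) (pathStep (suc m) b x (suc zero))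

returns⇔flowsCancel : ∀ x b₀ r b₁ s → b₀ + b₁ ≡ 0ℤ → (x + b₀ + r + b₁ + s ≡ x) ⇔ (r + s ≡ 0ℤ)
returns⇔flowsCancel x b₀ r b₁ s b₀+b₁≡0 = mk⇔
  (λ returns → Equivalence.to (x+y≡x⇔y≡0 x (r + s)) (trans (sym regroup) returns))
  (λ cancel → trans regroup (Equivalence.from (x+y≡x⇔y≡0 x (r + s)) cancel))
  where
  regroup : x + b₀ + r + b₁ + s ≡ x + (r + s)
  regroup = begin
    x + b₀ + r + b₁ + s           ≡⟨ rearrange x b₀ r b₁ s ⟩
    x + ((b₀ + b₁) + (r + s))     ≡⟨ cong (λ c → x + (c + (r + s))) b₀+b₁≡0 ⟩
    x + (0ℤ + (r + s))            ≡⟨ cong (x +_) (ℤ.+-identityˡ (r + s)) ⟩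
    x + (r + s)                   ∎
    where
    open ≡-Reasoning
    rearrange : ∀ x b₀ r b₁ s → x + b₀ + r + b₁ + s ≡ x + ((b₀ + b₁) + (r + s))
    rearrange = solve-∀

twoPeriodic⇒flowsReverse : ∀ m b₀ b₁ (x : Config (suc m)) → b₀ + b₁ ≡ 0ℤ →
  TwoPeriodic m b₀ b₁ x → FlowsReverse m b₀ x
twoPeriodic⇒flowsReverse zero    b₀ b₁ x _        _        = tt
twoPeriodic⇒flowsReverse (suc m) b₀ b₁ x b₀+b₁≡0 periodic =
  headReverses , twoPeriodic⇒flowsReverse m _ _ (x ∘ suc) (tailGainsCancel m b₀ x headReverses) (periodic ∘ suc)
  where
  headReverses : twoStepFlow m b₀ x ≡ 0ℤ
  headReverses = Equivalence.to (returns⇔flowsCancel (x zero) b₀ _ b₁ _ b₀+b₁≡0) (periodic zero)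

flowsReverse⇒twoPeriodic : ∀ m b₀ b₁ (x : Config (suc m)) → b₀ + b₁ ≡ 0ℤ →
  FlowsReverse m b₀ x → TwoPeriodic m b₀ b₁ x
flowsReverse⇒twoPeriodic zero    b₀ b₁ x b₀+b₁≡0 _ zero =
  Equivalence.from (returns⇔flowsCancel (x zero) b₀ 0ℤ b₁ 0ℤ b₀+b₁≡0) refl
flowsReverse⇒twoPeriodic (suc m) b₀ b₁ x b₀+b₁≡0 (headReverses , _) zero =
  Equivalence.from (returns⇔flowsCancel (x zero) b₀ _ b₁ _ b₀+b₁≡0) headReverses
flowsReverse⇒twoPeriodic (suc m) b₀ b₁ x _ (headReverses , tailReverses) (suc v) =
  flowsReverse⇒twoPeriodic m _ _ (x ∘ suc) (tailGainsCancel m b₀ x headReverses) tailReverses v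

Flat : ∀ m → Config (suc m) → Set
Flat zero    x = ⊤
Flat (suc m) x = x zero ≡ x (suc zero) × Flat m (x ∘ suc)

stays⇔noInflow : ∀ x b h → b ≡ 0ℤ → (x + b + h ≡ x) ⇔ (h ≡ 0ℤ)
stays⇔noInflow x _ h refl = subst (λ y → (y + h ≡ x) ⇔ (h ≡ 0ℤ)) (sym (ℤ.+-identityʳ x)) (x+y≡x⇔y≡0 x h)

fixed⇒flat : ∀ m b (x : Config (suc m)) → b ≡ 0ℤ → Fixed m b x → Flat m x
fixed⇒flat zero    b x _   _     = tt
fixed⇒flat (suc m) b x b≡0 fixed = x₀≡x₁ , fixed⇒flat m _ (x ∘ suc) (inflow-self (sym x₀≡x₁)) (fixed ∘ suc)
  where
  x₀≡x₁ : x zero ≡ x (suc zero)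
  x₀≡x₁ = inflow≡0⇒≡ _ _ (Equivalence.to (stays⇔noInflow (x zero) b _ b≡0) (fixed zero))

flat⇒fixed : ∀ m b (x : Config (suc m)) → b ≡ 0ℤ → Flat m x → Fixed m b x
flat⇒fixed zero    b x b≡0 _ zero = Equivalence.from (stays⇔noInflow (x zero) b 0ℤ b≡0) refl
flat⇒fixed (suc m) b x b≡0 (x₀≡x₁ , _) zero = Equivalence.from (stays⇔noInflow (x zero) b _ b≡0) (inflow-self x₀≡x₁)
flat⇒fixed (suc m) b x _   (x₀≡x₁ , tailFlat) (suc v) = flat⇒fixed m _ (x ∘ suc) (inflow-self (sym x₀≡x₁)) tailFlat v

IsP2-path⇔ : ∀ m (x : Config (suc m)) → IsP2 (pathGraph (suc m)) x ⇔ (FlowsReverse m 0ℤ x × ¬ Flat m x)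
IsP2-path⇔ m x = mk⇔
  (λ p → let (period2 , notFixed) = Equivalence.to (IsP2⇔exactPeriod2 G x) p in
    twoPeriodic⇒flowsReverse m 0ℤ 0ℤ x refl (λ v → trans (sym (step² v)) (period2 v)) ,
    λ isFlat → notFixed (λ v → trans (step-pathGraph m x v) (flat⇒fixed m 0ℤ x refl isFlat v)))
  (λ (reverses , notFlat) → Equivalence.from (IsP2⇔exactPeriod2 G x)
    ((λ v → trans (step² v) (flowsReverse⇒twoPeriodic m 0ℤ 0ℤ x refl reverses v)) ,
     λ fixed → notFlat (fixed⇒flat m 0ℤ x refl (λ v → trans (sym (step-pathGraph m x v)) (fixed v)))))
  where
  G = pathGraph (suc m)
  step² : step G (step G x) ≈C pathStep m 0ℤ (pathStep m 0ℤ x)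
  step² v = trans (step-cong G (step-pathGraph m x) v) (step-pathGraph m (pathStep m 0ℤ x) v)

-- the chips the last vertex gains from its neighbour, or from outside if it is the only vertex
lastInflow : ∀ m → ℤ → Config (suc m) → ℤ
lastInflow zero    b x = b
lastInflow (suc m) b x = lastInflow m (inflow (x (suc zero)) (x zero)) (x ∘ suc)

flat⇒headInflow≡0 : ∀ m (x : Config (suc m)) → Flat m x → headInflow m x ≡ 0ℤ
flat⇒headInflow≡0 zero    x _           = refl
flat⇒headInflow≡0 (suc m) x (x₀≡x₁ , _) = inflow-self x₀≡x₁

flat⇒lastInflow≡0 : ∀ m b (x : Config (suc m)) → b ≡ 0ℤ → Flat m x → lastInflow m b x ≡ 0ℤ
flat⇒lastInflow≡0 zero    b x b≡0 _              = b≡0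
flat⇒lastInflow≡0 (suc m) b x _   (x₀≡x₁ , tailFlat) =
  flat⇒lastInflow≡0 m _ (x ∘ suc) (inflow-self (sym x₀≡x₁)) tailFlat

-- b and n are what the two ends of a flat edge gain from their other neighbours.
stays-flat⇔equal-gains : ∀ {x₀ x₁} b n → x₀ ≡ x₁ →
  (x₀ + b + inflow x₀ x₁ ≡ x₁ + inflow x₁ x₀ + n) ⇔ (b ≡ n)
stays-flat⇔equal-gains {x₀} b n refl rewrite inflow-self {x₀} refl | ℤ.+-identityʳ (x₀ + b) | ℤ.+-identityʳ x₀ =
  mk⇔ (∙-cancelˡ x₀ b n) (cong (x₀ +_))

twoStepFlow≡0⇒stays-flat : ∀ m b (x : Config (suc (suc m))) → twoStepFlow m b x ≡ 0ℤ → x zero ≡ x (suc zero) →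
  pathStep (suc m) b x zero ≡ pathStep (suc m) b x (suc zero)
twoStepFlow≡0⇒stays-flat m b x reverses x₀≡x₁ = inflow≡0⇒≡ _ _ (x+y≡0∧x≡0⇒y≡0 reverses (inflow-self x₀≡x₁))

flowsReverse∧quietHead⇒flat : ∀ m b (x : Config (suc m)) → FlowsReverse m b x →
  b ≡ 0ℤ → headInflow m x ≡ 0ℤ → Flat m x
flowsReverse∧quietHead⇒flat zero    b x _                            _   _     = tt
flowsReverse∧quietHead⇒flat (suc m) b x (headReverses , tailReverses) b≡0 quiet =
  x₀≡x₁ , flowsReverse∧quietHead⇒flat m _ (x ∘ suc) tailReverses (inflow-self (sym x₀≡x₁)) tailQuiet
  where
  x₀≡x₁ : x zero ≡ x (suc zero)
  x₀≡x₁ = inflow≡0⇒≡ _ _ quiet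
  b≡tailGain : b ≡ headInflow m (x ∘ suc)
  b≡tailGain = Equivalence.to (stays-flat⇔equal-gains b _ x₀≡x₁) (twoStepFlow≡0⇒stays-flat m b x headReverses x₀≡x₁)
  tailQuiet : headInflow m (x ∘ suc) ≡ 0ℤ
  tailQuiet = trans (sym b≡tailGain) b≡0

flowsReverse∧quietEnd⇒flat : ∀ m b (x : Config (suc m)) → FlowsReverse m b x →
  lastInflow m b x ≡ 0ℤ → Flat m x × b ≡ 0ℤ
flowsReverse∧quietEnd⇒flat zero    b x _                            quiet = tt , quiet
flowsReverse∧quietEnd⇒flat (suc m) b x (headReverses , tailReverses) quiet =
  (x₀≡x₁ , tailFlat) , trans b≡tailGain (flat⇒headInflow≡0 m (x ∘ suc) tailFlat)
  where
  tail : Flat m (x ∘ suc) × inflow (x (suc zero)) (x zero) ≡ 0ℤ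
  tail = flowsReverse∧quietEnd⇒flat m _ (x ∘ suc) tailReverses quiet
  tailFlat = proj₁ tail
  x₀≡x₁ : x zero ≡ x (suc zero)
  x₀≡x₁ = sym (inflow≡0⇒≡ _ _ (proj₂ tail))
  b≡tailGain : b ≡ headInflow m (x ∘ suc)
  b≡tailGain = Equivalence.to (stays-flat⇔equal-gains b _ x₀≡x₁) (twoStepFlow≡0⇒stays-flat m b x headReverses x₀≡x₁)

-- Gluing along a flat edge

shift : ∀ {n} → ℤ → Config n → Config n
shift c y k = y k + c

-- x followed by y raised by the height of the last vertex of x;
-- the joining edge is flat iff y vanishes at its first vertex.
glue : ∀ a {b} → Config (suc a) → Config (suc b) → Config (suc a +ℕ suc b)
glue a       x y zero    = x zero
glue zero    x y (suc k) = y k + x zero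
glue (suc a) x y (suc k) = glue a (x ∘ suc) y k

left : ∀ a {b} → Config (suc a +ℕ suc b) → Config (suc a)
left a       z zero    = z zero
left zero    z (suc ())
left (suc a) z (suc k) = left a (z ∘ suc) k

right : ∀ a {b} → Config (suc a +ℕ suc b) → Config (suc b)
right zero    z k = z (suc k) - z zero
right (suc a) z   = right a (z ∘ suc)

glue-left-right : ∀ a {b} (z : Config (suc a +ℕ suc b)) → z ≈C glue a (left a z) (right a z)
glue-left-right a       z zero    = refl
glue-left-right zero    z (suc k) = sym (//-rightDividesˡ (z zero) (z (suc k)))
glue-left-right (suc a) z (suc k) = glue-left-right a (z ∘ suc) k

left-glue : ∀ a {b} (x : Config (suc a)) (y : Config (suc b)) → left a (glue a x y) ≈C x
left-glue a       x y zero    = refl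
left-glue (suc a) x y (suc k) = left-glue a (x ∘ suc) y k

right-glue : ∀ a {b} (x : Config (suc a)) (y : Config (suc b)) → right a (glue a x y) ≈C y
right-glue zero    x y k = //-rightDividesʳ (x zero) (y k)
right-glue (suc a) x y   = right-glue a (x ∘ suc) y

glue-cong : ∀ a {b} {x x′ : Config (suc a)} {y y′ : Config (suc b)} →
  x ≈C x′ → y ≈C y′ → glue a x y ≈C glue a x′ y′
glue-cong a       x≈x′ y≈y′ zero    = x≈x′ zero
glue-cong zero    x≈x′ y≈y′ (suc k) = cong₂ _+_ (y≈y′ k) (x≈x′ zero)
glue-cong (suc a) x≈x′ y≈y′ (suc k) = glue-cong a (x≈x′ ∘ suc) y≈y′ k

left-cong : ∀ a {b} {z z′ : Config (suc a +ℕ suc b)} → z ≈C z′ → left a z ≈C left a z′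
left-cong a       z≈z′ zero    = z≈z′ zero
left-cong (suc a) z≈z′ (suc k) = left-cong a (z≈z′ ∘ suc) k

right-cong : ∀ a {b} {z z′ : Config (suc a +ℕ suc b)} → z ≈C z′ → right a z ≈C right a z′
right-cong zero    z≈z′ k = cong₂ _-_ (z≈z′ (suc k)) (z≈z′ zero)
right-cong (suc a) z≈z′   = right-cong a (z≈z′ ∘ suc)

glueSplitting : ∀ a b → Splitting (suc a +ℕ suc b) (suc a) (suc b)
glueSplitting a b = record
  { join = glue a ; first = left a ; second = right a
  ; join-split = glue-left-right a ; first-join = left-glue a ; second-join = right-glue a
  ; join-cong = glue-cong a ; first-cong = left-cong a ; second-cong = right-cong a }

headInflow-shift : ∀ m c (y : Config (suc m)) → headInflow m (shift c y) ≡ headInflow m y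
headInflow-shift zero    c y = refl
headInflow-shift (suc m) c y = inflow-+ʳ (y zero) (y (suc zero)) c

pathStep-shift : ∀ m b c (y : Config (suc m)) → pathStep m b (shift c y) ≈C shift c (pathStep m b y)
pathStep-shift m b c y zero rewrite headInflow-shift m c y = swap (y zero) c b (headInflow m y)
  where
  swap : ∀ y c b h → y + c + b + h ≡ y + b + h + c
  swap = solve-∀
pathStep-shift (suc m) b c y (suc v) rewrite inflow-+ʳ (y (suc zero)) (y zero) c = pathStep-shift m _ c (y ∘ suc) v

twoStepFlow-shift : ∀ m b c (y : Config (suc (suc m))) → twoStepFlow m b (shift c y) ≡ twoStepFlow m b y
twoStepFlow-shift m b c y = cong₂ _+_ (inflow-+ʳ (y zero) (y (suc zero)) c) (begin
  inflow (pathStep (suc m) b (shift c y) zero) (pathStep (suc m) b (shift c y) (suc zero))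
    ≡⟨ cong₂ inflow (pathStep-shift (suc m) b c y zero) (pathStep-shift (suc m) b c y (suc zero)) ⟩
  inflow (pathStep (suc m) b y zero + c) (pathStep (suc m) b y (suc zero) + c)
    ≡⟨ inflow-+ʳ (pathStep (suc m) b y zero) (pathStep (suc m) b y (suc zero)) c ⟩
  inflow (pathStep (suc m) b y zero) (pathStep (suc m) b y (suc zero)) ∎)
  where open ≡-Reasoning

FlowsReverse-shift : ∀ m b c (y : Config (suc m)) → FlowsReverse m b (shift c y) ⇔ FlowsReverse m b y
FlowsReverse-shift zero    b c y = mk⇔ (λ _ → tt) (λ _ → tt)
FlowsReverse-shift (suc m) b c y =
  mk⇔ (trans (sym (twoStepFlow-shift m b c y))) (trans (twoStepFlow-shift m b c y))
  ×-⇔ subst (λ b′ → FlowsReverse m b′ (shift c (y ∘ suc)) ⇔ FlowsReverse m (inflow (y (suc zero)) (y zero)) (y ∘ suc))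
            (sym (inflow-+ʳ (y (suc zero)) (y zero) c))
            (FlowsReverse-shift m _ c (y ∘ suc))

Flat-shift : ∀ m c (y : Config (suc m)) → Flat m y → Flat m (shift c y)
Flat-shift zero    c y _                   = tt
Flat-shift (suc m) c y (y₀≡y₁ , tailFlat) = cong (_+ c) y₀≡y₁ , Flat-shift m c (y ∘ suc) tailFlat

glue-junction : ∀ c {b} (y : Config (suc b)) → y zero ≡ 0ℤ → c ≡ y zero + c
glue-junction c y y₀≡0 = sym (trans (cong (_+ c) y₀≡0) (ℤ.+-identityˡ c))

headInflow-glue : ∀ a {b} (x : Config (suc a)) (y : Config (suc b)) → y zero ≡ 0ℤ →
  headInflow (a +ℕ suc b) (glue a x y) ≡ headInflow a x
headInflow-glue zero    x y y₀≡0 = inflow-self (glue-junction (x zero) y y₀≡0)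
headInflow-glue (suc a) x y _    = refl

twoStepFlow-glue : ∀ a {b} p (x : Config (suc (suc a))) (y : Config (suc b)) → y zero ≡ 0ℤ →
  twoStepFlow (a +ℕ suc b) p (glue (suc a) x y) ≡ twoStepFlow a p x
twoStepFlow-glue a p x y y₀≡0 =
  cong (λ h → inflow (x zero) (x (suc zero)) + inflow (pathStep (suc a) p x zero) (x (suc zero) + inflow (x (suc zero)) (x zero) + h))
       (headInflow-glue a (x ∘ suc) y y₀≡0)

junction-stays-flat⇔ : ∀ {b} p (x : Config 1) (y : Config (suc b)) → y zero ≡ 0ℤ →
  (twoStepFlow b p (glue zero x y) ≡ 0ℤ) ⇔ (p ≡ headInflow b y)
junction-stays-flat⇔ {b} p x y y₀≡0 = mk⇔
  (λ reverses → trans (Equivalence.to (stays-flat⇔equal-gains p _ flatJunction)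
                                       (twoStepFlow≡0⇒stays-flat b p z reverses flatJunction))
                      (headInflow-shift b (x zero) y))
  (λ p≡h → cong₂ _+_ (inflow-self flatJunction)
                       (inflow-self (Equivalence.from (stays-flat⇔equal-gains p _ flatJunction)
                                                      (trans p≡h (sym (headInflow-shift b (x zero) y))))))
  where
  z = glue zero x y
  flatJunction : z zero ≡ z (suc zero)
  flatJunction = glue-junction (x zero) y y₀≡0

FlowsReverse-glue⇒ : ∀ a {b} p (x : Config (suc a)) (y : Config (suc b)) → y zero ≡ 0ℤ →
  FlowsReverse (a +ℕ suc b) p (glue a x y) → FlowsReverse a p x × FlowsReverse b 0ℤ y × lastInflow a p x ≡ headInflow b y
FlowsReverse-glue⇒ zero {b} p x y y₀≡0 (junction , yReverses) =
  tt ,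
  Equivalence.to (FlowsReverse-shift b 0ℤ (x zero) y)
    (subst (λ b′ → FlowsReverse b b′ (shift (x zero) y)) (inflow-self (sym (glue-junction (x zero) y y₀≡0))) yReverses) ,
  Equivalence.to (junction-stays-flat⇔ p x y y₀≡0) junction
FlowsReverse-glue⇒ (suc a) p x y y₀≡0 (first , rest) =
  let (xRest , yReverses , ends) = FlowsReverse-glue⇒ a _ (x ∘ suc) y y₀≡0 rest in
  (trans (sym (twoStepFlow-glue a p x y y₀≡0)) first , xRest) , yReverses , ends

FlowsReverse-glue⇐ : ∀ a {b} p (x : Config (suc a)) (y : Config (suc b)) → y zero ≡ 0ℤ →
  FlowsReverse a p x → FlowsReverse b 0ℤ y → lastInflow a p x ≡ headInflow b y → FlowsReverse (a +ℕ suc b) p (glue a x y)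
FlowsReverse-glue⇐ zero {b} p x y y₀≡0 _ yReverses ends =
  Equivalence.from (junction-stays-flat⇔ p x y y₀≡0) ends ,
  subst (λ b′ → FlowsReverse b b′ (shift (x zero) y)) (sym (inflow-self (sym (glue-junction (x zero) y y₀≡0))))
    (Equivalence.from (FlowsReverse-shift b 0ℤ (x zero) y) yReverses)
FlowsReverse-glue⇐ (suc a) p x y y₀≡0 (first , xRest) yReverses ends =
  trans (twoStepFlow-glue a p x y y₀≡0) first , FlowsReverse-glue⇐ a _ (x ∘ suc) y y₀≡0 xRest yReverses ends

Flat-glue : ∀ a {b} (x : Config (suc a)) (y : Config (suc b)) → y zero ≡ 0ℤ →
  Flat a x → Flat b y → Flat (a +ℕ suc b) (glue a x y)
Flat-glue zero    x y y₀≡0 _                  yFlat = glue-junction (x zero) y y₀≡0 , Flat-shift _ (x zero) y yFlat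
Flat-glue (suc a) x y y₀≡0 (x₀≡x₁ , tailFlat) yFlat = x₀≡x₁ , Flat-glue a (x ∘ suc) y y₀≡0 tailFlat yFlat

Flat-glue⇒Flat-left : ∀ a {b} (x : Config (suc a)) (y : Config (suc b)) → Flat (a +ℕ suc b) (glue a x y) → Flat a x
Flat-glue⇒Flat-left zero    x y _                  = tt
Flat-glue⇒Flat-left (suc a) x y (x₀≡x₁ , tailFlat) = x₀≡x₁ , Flat-glue⇒Flat-left a (x ∘ suc) y tailFlat

IsP2-glue⇔ : ∀ a {b} (x : Config (suc a)) (y : Config (suc b)) → y zero ≡ 0ℤ →
  IsP2 (pathGraph (suc a +ℕ suc b)) (glue a x y) ⇔
  (IsP2 (pathGraph (suc a)) x × IsP2 (pathGraph (suc b)) y × lastInflow a 0ℤ x ≡ headInflow b y)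
IsP2-glue⇔ a {b} x y y₀≡0 = mk⇔ split join
  where
  Pieces : Set
  Pieces = IsP2 (pathGraph (suc a)) x × IsP2 (pathGraph (suc b)) y × lastInflow a 0ℤ x ≡ headInflow b y
  split : IsP2 (pathGraph (suc a +ℕ suc b)) (glue a x y) → Pieces
  split p =
    let (zReverses , zNotFlat) = Equivalence.to (IsP2-path⇔ (a +ℕ suc b) (glue a x y)) p
        (xReverses , yReverses , ends) = FlowsReverse-glue⇒ a 0ℤ x y y₀≡0 zReverses
        xNotFlat : ¬ Flat a x
        xNotFlat xFlat = zNotFlat (Flat-glue a x y y₀≡0 xFlat
          (flowsReverse∧quietHead⇒flat b 0ℤ y yReverses refl (trans (sym ends) (flat⇒lastInflow≡0 a 0ℤ x refl xFlat))))
        yNotFlat : ¬ Flat b y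
        yNotFlat yFlat = zNotFlat (Flat-glue a x y y₀≡0
          (proj₁ (flowsReverse∧quietEnd⇒flat a 0ℤ x xReverses (trans ends (flat⇒headInflow≡0 b y yFlat)))) yFlat)
    in Equivalence.from (IsP2-path⇔ a x) (xReverses , xNotFlat) ,
       Equivalence.from (IsP2-path⇔ b y) (yReverses , yNotFlat) , ends
  join : Pieces → IsP2 (pathGraph (suc a +ℕ suc b)) (glue a x y)
  join (px , py , ends) =
    let (xReverses , xNotFlat) = Equivalence.to (IsP2-path⇔ a x) px
        (yReverses , _) = Equivalence.to (IsP2-path⇔ b y) py
    in Equivalence.from (IsP2-path⇔ (a +ℕ suc b) (glue a x y))
         (FlowsReverse-glue⇐ a 0ℤ x y y₀≡0 xReverses yReverses ends , xNotFlat ∘ Flat-glue⇒Flat-left a x y)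

inducedOri-cong : ∀ n {x x′ : Config n} → x ≈C x′ → inducedOri n x ≡ inducedOri n x′
inducedOri-cong zero          _    = refl
inducedOri-cong (suc zero)    _    = refl
inducedOri-cong (suc (suc n)) x≈x′ =
  cong₂ _∷_ (cong₂ edgeOri (x≈x′ zero) (x≈x′ (suc zero))) (inducedOri-cong (suc n) (x≈x′ ∘ suc))

inducedOri-shift : ∀ n c (y : Config n) → inducedOri n (shift c y) ≡ inducedOri n y
inducedOri-shift zero          c y = refl
inducedOri-shift (suc zero)    c y = refl
inducedOri-shift (suc (suc n)) c y = cong₂ _∷_ (edgeOri-+ʳ (y zero) (y (suc zero)) c) (inducedOri-shift (suc n) c (y ∘ suc))

length-inducedOri : ∀ a (x : Config (suc a)) → length (inducedOri (suc a) x) ≡ a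
length-inducedOri zero    x = refl
length-inducedOri (suc a) x = cong suc (length-inducedOri a (x ∘ suc))

inducedOri-glue : ∀ a {b} (x : Config (suc a)) (y : Config (suc b)) →
  inducedOri (suc a +ℕ suc b) (glue a x y) ≡ inducedOri (suc a) x ++ edgeOri 0ℤ (y zero) ∷ inducedOri (suc b) y
inducedOri-glue zero {b} x y = cong₂ _∷_ junction (inducedOri-shift (suc b) (x zero) y)
  where
  junction : edgeOri (x zero) (y zero + x zero) ≡ edgeOri 0ℤ (y zero)
  junction = trans (cong (λ c → edgeOri c (y zero + x zero)) (sym (ℤ.+-identityˡ (x zero)))) (edgeOri-+ʳ 0ℤ (y zero) (x zero))
inducedOri-glue (suc a) x y = cong (_ ∷_) (inducedOri-glue a (x ∘ suc) y)

headInflowOf : List EdgeOri → ℤ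
headInflowOf []      = 0ℤ
headInflowOf (o ∷ _) = edgeInflow o

lastInflowOf : ℤ → List EdgeOri → ℤ
lastInflowOf b []       = b
lastInflowOf b (o ∷ os) = lastInflowOf (- edgeInflow o) os

headInflow≡headInflowOf : ∀ m (x : Config (suc m)) → headInflow m x ≡ headInflowOf (inducedOri (suc m) x)
headInflow≡headInflowOf zero    x = refl
headInflow≡headInflowOf (suc m) x = inflow≡edgeInflow (x zero) (x (suc zero))

lastInflow≡lastInflowOf : ∀ m b (x : Config (suc m)) → lastInflow m b x ≡ lastInflowOf b (inducedOri (suc m) x)
lastInflow≡lastInflowOf zero    b x = refl
lastInflow≡lastInflowOf (suc m) b x = begin
  lastInflow m (inflow x₁ x₀) (x ∘ suc)                        ≡⟨ lastInflow≡lastInflowOf m _ (x ∘ suc) ⟩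
  lastInflowOf (inflow x₁ x₀) (inducedOri (suc m) (x ∘ suc))   ≡⟨ cong (λ c → lastInflowOf c (inducedOri _ (x ∘ suc))) reversed ⟩
  lastInflowOf (- edgeInflow (edgeOri x₀ x₁)) (inducedOri (suc m) (x ∘ suc)) ∎
  where
  open ≡-Reasoning
  x₀ = x zero
  x₁ = x (suc zero)
  reversed : inflow x₁ x₀ ≡ - edgeInflow (edgeOri x₀ x₁)
  reversed = trans (inflow-antisym x₀ x₁) (cong -_ (inflow≡edgeInflow x₀ x₁))

-- The two ends of a flat edge joining subpaths oriented S and T gain equally in the next step.
Compatible : List EdgeOri → List EdgeOri → Set
Compatible S T = lastInflowOf 0ℤ S ≡ headInflowOf T

P2Inducing : ∀ n → List EdgeOri → Config n → Set
P2Inducing n S D = IsP2 (pathGraph n) D × inducedOri n D ≡ S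

P2Inducing-split : ∀ S T (z : Config (suc (length S) +ℕ suc (length T))) → P2Inducing _ (S ++ flat ∷ T) z →
  P2Inducing (suc (length S)) S (left _ z) × P2Inducing (suc (length T)) T (right _ z) × right _ z zero ≡ 0ℤ × Compatible S T
P2Inducing-split S T z (pz , oriz) =
  (px , oriS) , (py , oriT) , y₀≡0 , compatible
  where
  a = length S
  x = left a z
  y = right a z
  z≈glue = glue-left-right a z
  pieces : inducedOri (suc a) x ≡ S × edgeOri 0ℤ (y zero) ∷ inducedOri _ y ≡ flat ∷ T
  pieces = ++-injective _ S (length-inducedOri a x)
    (trans (sym (inducedOri-glue a x y)) (trans (sym (inducedOri-cong _ z≈glue)) oriz))
  oriS : inducedOri (suc a) x ≡ S
  oriS = proj₁ pieces
  oriT : inducedOri _ y ≡ T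
  oriT = ∷-injectiveʳ (proj₂ pieces)
  y₀≡0 : y zero ≡ 0ℤ
  y₀≡0 = sym (edgeOri≡flat⇒≡ 0ℤ (y zero) (∷-injectiveˡ (proj₂ pieces)))
  parts : IsP2 (pathGraph (suc a)) x × IsP2 (pathGraph _) y × lastInflow a 0ℤ x ≡ headInflow _ y
  parts = Equivalence.to (IsP2-glue⇔ a x y y₀≡0) (IsP2-cong _ z≈glue pz)
  px = proj₁ parts
  py = proj₁ (proj₂ parts)
  compatible : Compatible S T
  compatible = begin
    lastInflowOf 0ℤ S                         ≡⟨ cong (lastInflowOf 0ℤ) oriS ⟨
    lastInflowOf 0ℤ (inducedOri (suc a) x)    ≡⟨ lastInflow≡lastInflowOf a 0ℤ x ⟨
    lastInflow a 0ℤ x                         ≡⟨ proj₂ (proj₂ parts) ⟩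
    headInflow _ y                            ≡⟨ headInflow≡headInflowOf _ y ⟩
    headInflowOf (inducedOri _ y)             ≡⟨ cong headInflowOf oriT ⟩
    headInflowOf T                            ∎
    where open ≡-Reasoning

P2Inducing-glue : ∀ {a b} S T (x : Config (suc a)) (y : Config (suc b)) → y zero ≡ 0ℤ → Compatible S T →
  P2Inducing _ S x → P2Inducing _ T y → P2Inducing _ (S ++ flat ∷ T) (glue a x y)
P2Inducing-glue {a} S T x y y₀≡0 compatible (px , refl) (py , refl) =
  Equivalence.from (IsP2-glue⇔ a x y y₀≡0) (px , py , ends) ,
  trans (inducedOri-glue a x y) (cong (λ o → inducedOri _ x ++ o ∷ inducedOri _ y) (edgeOri-self (sym y₀≡0)))
  where
  ends : lastInflow a 0ℤ x ≡ headInflow _ y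
  ends = trans (lastInflow≡lastInflowOf a 0ℤ x) (trans compatible (sym (headInflow≡headInflowOf _ y)))

Counts-glue : ∀ S T {c d} → Compatible S T → Counts (NPred (length S) S) c → Counts (NPred (length T) T) d →
  Counts (NPred (length S +ℕ suc (length T)) (S ++ flat ∷ T)) (c * d)
Counts-glue S T compatible = Counts-× (glueSplitting (length S) (length T)) joinP splitP
  where
  joinP : ∀ x y → NPred _ S x → NPred _ T y → NPred _ (S ++ flat ∷ T) (glue (length S) x y)
  joinP x y (px , oriS , x₀≡0) (py , oriT , y₀≡0) =
    let (pz , oriz) = P2Inducing-glue S T x y y₀≡0 compatible (px , oriS) (py , oriT) in pz , oriz , x₀≡0
  splitP : ∀ z → NPred _ (S ++ flat ∷ T) z → NPred _ S (left _ z) × NPred _ T (right _ z)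
  splitP z (pz , oriz , z₀≡0) =
    let ((px , oriS) , (py , oriT) , y₀≡0 , _) = P2Inducing-split S T z (pz , oriz) in (px , oriS , z₀≡0) , (py , oriT , y₀≡0)

IsP2Orientation-split : ∀ S T → IsP2Orientation (suc (length S) +ℕ suc (length T)) (S ++ flat ∷ T) →
  Compatible S T × IsP2Orientation (suc (length T)) T
IsP2Orientation-split S T (z , pz , oriz) =
  let (_ , (py , oriT) , _ , compatible) = P2Inducing-split S T z (pz , oriz) in compatible , right _ z , py , oriT

Counts-intercalate : ∀ Ss → Ss ≢ [] →
  IsP2Orientation (suc (length (intercalate (flat ∷ []) Ss))) (intercalate (flat ∷ []) Ss) →
  ∀ cs → Pointwise (λ S c → Counts (NPred (length S) S) c) Ss cs →
  Counts (NPred (length (intercalate (flat ∷ []) Ss)) (intercalate (flat ∷ []) Ss)) (product cs)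
Counts-intercalate []            Ss≢[] _ _        _              = ⊥-elim (Ss≢[] refl)
Counts-intercalate (S ∷ [])      _     _ (c ∷ []) (count ∷ [])   = subst (Counts _) (sym (*-identityʳ c)) count
Counts-intercalate (S ∷ S′ ∷ Ss) _     p (c ∷ cs) (count ∷ counts) =
  let (compatible , pT) = IsP2Orientation-split S T (subst (λ n → IsP2Orientation (suc n) (S ++ flat ∷ T)) |R| p) in
  subst (λ n → Counts (NPred n (S ++ flat ∷ T)) (c * product cs)) (sym |R|)
    (Counts-glue S T compatible count (Counts-intercalate (S′ ∷ Ss) (λ ()) pT cs counts))
  where
  T = intercalate (flat ∷ []) (S′ ∷ Ss)
  |R| : length (S ++ flat ∷ T) ≡ length S +ℕ suc (length T)
  |R| = length-++ S

corollary4 : (n : ℕ) (R : List EdgeOri) → length R ≡ n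
    → IsP2Orientation (suc n) R
    → (Ss : List (List EdgeOri)) → Ss ≢ []
    → R ≡ intercalate (flat ∷ []) Ss
    → (cs : List ℕ)
    → Pointwise (λ S c → Counts (NPred (length S) S) c) Ss cs
    → Counts (NPred n R) (product cs)
corollary4 _ _ refl p Ss Ss≢[] refl = Counts-intercalate Ss Ss≢[] p
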